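{- For every composition $\alpha=(\alpha_1,\dots,\alpha_l)$ of $n\ge1$, \[\mathrm{MaxOne}(\psi_\alpha)=\sum_{i=1}^{l}\frac{(-1)^{l-i}}{\pi(\alpha_1\cdots\alpha_{i-1})\cdot\pi((\alpha_{i+1}\cdots\alpha_l)^{\mathrm{rev}})},\] and $\mathrm{MinOne}(\psi_\alpha)=1$ if $\alpha=(n)$ and $\mathrm{MinOne}(\psi_\alpha)=0$ otherwise.
   Context: For a composition $\gamma=(\gamma_1,\dots,\gamma_k)$, $\pi(\gamma)=\prod_{i=1}^{k}(\gamma_1+\cdots+\gamma_i)$ (equal to $1$ for the empty composition), and $\gamma^{\mathrm{rev}}$ is its reversal; $\alpha_1\cdots\alpha_{i-1}$ denotes the composition $(\alpha_1,\dots,\alpha_{i-1})$. If $\alpha$ refines $\beta$, $\alpha^{(i)}$ is the composition of parts of $\alpha$ summing to $\beta_i$ and $\pi(\alpha,\beta)=\prod_i\pi(\alpha^{(i)})$. $\psi_\alpha=\sum_{\beta\text{ coarsens }\alpha}\frac{1}{\pi(\alpha,\beta)}M_\beta$ with $M_\beta$ the monomial quasisymmetric functions. $\mathrm{MinOne}$, $\mathrm{MaxOne}$ are the linear functionals on quasisymmetric functions with $\mathrm{MinOne}(L_\beta)=(-1)^k$ if $\beta=(1^k,n-k)$, $0\le k<n$, and $0$ otherwise; $\mathrm{MaxOne}(L_\beta)=(-1)^k$ if $\beta=(n-k,1^k)$, $0\le k<n$, and $0$ otherwise, where $L_\beta=\sum_{\gamma\text{ refines }\beta}M_\gamma$. 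-}

module Defs where

open import Data.Nat using (ℕ; zero; suc; _+_; _*_; _∸_; _≤_)
open import Data.List using (List; []; _∷_; _++_; map; concatMap; length; take; drop; reverse; upTo)
open import Data.Nat.ListAction using (sum; product)
open import Data.List.Relation.Unary.All using (All)
open import Data.Bool using (Bool; true; false; if_then_else_; _∧_)
open import Data.Integer using (+_)
open import Data.Rational using (ℚ; 0ℚ; 1ℚ; _/_; -_) renaming (_+_ to _+ℚ_; _*_ to _*ℚ_)
open import Data.Product using (_×_; _,_)
open import Relation.Binary.PropositionalEquality using (_≡_)

IsComposition : ℕ → List ℕ → Set
IsComposition n β = All (λ a → 1 ≤ a) β × sum β ≡ n

-- π(γ) = ∏_i (γ_1 + ... + γ_i); π([]) = 1
πc : List ℕ → ℕ
πc = go 0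
  where
  go : ℕ → List ℕ → ℕ
  go s [] = 1
  go s (a ∷ r) = (s + a) * go (s + a) r

-- 1/m for m ≥ 1 (convention: 0 for m = 0; only used on positive values)
inv : ℕ → ℚ
inv zero = 0ℚ
inv (suc k) = (+ 1) / suc k

sign : ℕ → ℚ
sign zero = 1ℚ
sign (suc k) = - sign k

sumℚ : List ℚ → ℚ
sumℚ [] = 0ℚ
sumℚ (x ∷ xs) = x +ℚ sumℚ xs

-- A homogeneous quasisymmetric function given as a formal ℚ-linear
-- combination Σ c · M_β, listed as pairs (c , β).
QSymElt : Set
QSymElt = List (ℚ × List ℕ)

-- A linear functional on QSym_n is determined by its values F β on the
-- monomial basis M_β; evalM F extends it linearly.
evalM : (List ℕ → ℚ) → QSymElt → ℚ
evalM F xs = sumℚ (map (λ { (c , β) → c *ℚ F β }) xs)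

comps : ℕ → List (List ℕ)
comps zero = [] ∷ []
comps (suc zero) = (1 ∷ []) ∷ []
comps (suc (suc k)) = map (1 ∷_) (comps (suc k)) ++ map incHead (comps (suc k))
  where
  incHead : List ℕ → List ℕ
  incHead [] = []
  incHead (a ∷ r) = suc a ∷ r

refinements : List ℕ → List (List ℕ)
refinements [] = [] ∷ []
refinements (b ∷ r) = concatMap (λ c → map (c ++_) (refinements r)) (comps b)

Lfun : List ℕ → QSymElt
Lfun β = map (λ γ → (1ℚ , γ)) (refinements β)

-- all ways to cut α into consecutive nonempty blocks α^(1),...,α^(k)
blockings : List ℕ → List (List (List ℕ))
blockings [] = [] ∷ []
blockings (a ∷ r) = concatMap step (blockings r)
  where
  step : List (List ℕ) → List (List (List ℕ))
  step [] = ((a ∷ []) ∷ []) ∷ []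
  step (b ∷ bs) = ((a ∷ []) ∷ b ∷ bs) ∷ ((a ∷ b) ∷ bs) ∷ []

-- ψ_α = Σ_{β coarsens α} (1/π(α,β)) M_β, β = sums of the blocks
psi : List ℕ → QSymElt
psi α = map (λ bs → (inv (product (map πc bs)) , map sum bs)) (blockings α)

allOnes : List ℕ → Bool
allOnes [] = true
allOnes (suc zero ∷ r) = allOnes r
allOnes (_ ∷ r) = false

maxOneVal : List ℕ → ℚ
maxOneVal [] = 0ℚ
maxOneVal (m ∷ r) = if allOnes r then sign (length r) else 0ℚ

-- MinOne(L_β) = (-1)^k if β = (1^k, n-k), 0 ≤ k < n, else 0
minOneVal : List ℕ → ℚ
minOneVal [] = 0ℚ
minOneVal (m ∷ []) = 1ℚ
minOneVal (suc zero ∷ r@(_ ∷ _)) = - minOneVal r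
minOneVal (_ ∷ _ ∷ _) = 0ℚ

-- F (values on the M basis) defines the functional MaxOne on QSym_n
IsMaxOne : ℕ → (List ℕ → ℚ) → Set
IsMaxOne n F = ∀ β → IsComposition n β → evalM F (Lfun β) ≡ maxOneVal β

IsMinOne : ℕ → (List ℕ → ℚ) → Set
IsMinOne n F = ∀ β → IsComposition n β → evalM F (Lfun β) ≡ minOneVal β

-- Σ_{i=1}^{l} (-1)^{l-i} / (π(α_1⋯α_{i-1}) · π((α_{i+1}⋯α_l)^rev)),
-- indexed by j = i - 1 ∈ {0,…,l-1}
maxOneFormula : List ℕ → ℚ
maxOneFormula α =
  sumℚ (map (λ j → sign (length α ∸ suc j)
                   *ℚ (inv (πc (take j α)) *ℚ inv (πc (reverse (drop (suc j) α)))))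
            (upTo (length α)))

-- MaxOne and MinOne are determined by their values on the L basis and hence, L_β being M_β plus
-- monomials of strictly finer compositions, by their values on the M basis: (-1)^(ℓ-1) β_1 and
-- (-1)^(ℓ-1) β_ℓ respectively.  In the resulting sum over the coarsenings of α, the part α_1 either
-- forms a block of its own or joins the next block.  This gives a two-term recurrence in α_2⋯α_l, in
-- which α_1 survives only as a shift s of the partial sums of the first block.  For MinOne the two terms
-- cancel unless l = 1.  For MaxOne the recurrence unwinds into the stated alternating sum, using that
-- the signed total weight of the coarsenings is ±1/(π((α_2⋯α_l)^rev)·(s+|α|)), which in turn follows
-- from the partial fraction 1/p·(1/(p+q) − 1/q) = −1/(q(p+q)).
module Submission where

open import Defs
open import Data.Bool using (true; false; if_then_else_)
open import Data.Empty using (⊥-elim)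
open import Data.Unit using (⊤; tt)
open import Data.Integer using (+_) renaming (_+_ to _+ℤ_)
import Data.Integer.Properties as ℤ
open import Data.List using (List; []; _∷_; _++_; map; concatMap; length; reverse; take; drop; upTo; applyUpTo)
import Data.List.Properties as List
open import Data.List.Relation.Binary.Permutation.Propositional.Properties using (↭-reverse)
open import Data.List.Relation.Unary.All as All using (All; []; _∷_)
open import Data.List.Relation.Unary.All.Properties using (++⁺; ++⁻ˡ; map⁺; gmap⁺; concat⁺)
open import Data.Nat using (ℕ; zero; suc; _+_; _*_; _∸_; _≤_; _<_; z≤n; s≤s)
import Data.Nat.Properties as ℕ
open import Data.Nat.Coprimality using (1-coprimeTo) renaming (sym to coprime-sym)
open import Data.Nat.ListAction using (sum; product)
open import Data.Nat.ListAction.Properties using (sum-++; sum-↭)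
open import Data.Product using (∃-syntax; _×_; _,_)
open import Data.Rational using (ℚ; 0ℚ; 1ℚ; mkℚ; -_; _/_)
  renaming (_+_ to _+ℚ_; _*_ to _*ℚ_; _-_ to _-ℚ_)
import Data.Rational.Properties as ℚ
open import Algebra.Properties.Group ℚ.+-0-group using (x∙y⁻¹≈ε⇒x≈y)
open import Data.Rational.Solver using (module +-*-Solver)
open import Function using (_∘_)
open import Relation.Binary.PropositionalEquality
open +-*-Solver

fromℕ : ℕ → ℚ
fromℕ zero    = 0ℚ
fromℕ (suc n) = 1ℚ +ℚ fromℕ n

fromℕ-+ : ∀ m n → fromℕ (m + n) ≡ fromℕ m +ℚ fromℕ n
fromℕ-+ zero    n = sym (ℚ.+-identityˡ (fromℕ n))
fromℕ-+ (suc m) n = trans (cong (1ℚ +ℚ_) (fromℕ-+ m n)) (sym (ℚ.+-assoc 1ℚ (fromℕ m) (fromℕ n)))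

fromℕ-* : ∀ m n → fromℕ (m * n) ≡ fromℕ m *ℚ fromℕ n
fromℕ-* zero    n = sym (ℚ.*-zeroˡ (fromℕ n))
fromℕ-* (suc m) n = begin
  fromℕ (n + m * n)              ≡⟨ fromℕ-+ n (m * n) ⟩
  fromℕ n +ℚ fromℕ (m * n)       ≡⟨ cong (fromℕ n +ℚ_) (fromℕ-* m n) ⟩
  fromℕ n +ℚ fromℕ m *ℚ fromℕ n  ≡⟨ solve 2 (λ a b → b :+ a :* b := (con 1ℚ :+ a) :* b) refl (fromℕ m) (fromℕ n) ⟩
  fromℕ (suc m) *ℚ fromℕ n       ∎
  where open ≡-Reasoning

n/1≡mkℚ : ∀ n → + n / 1 ≡ mkℚ (+ n) 0 (coprime-sym (1-coprimeTo n))
n/1≡mkℚ n = ℚ.normalize-coprime (coprime-sym (1-coprimeTo n))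

inv≡mkℚ : ∀ k → inv (suc k) ≡ mkℚ (+ 1) k (1-coprimeTo (suc k))
inv≡mkℚ k = ℚ.normalize-coprime (1-coprimeTo (suc k))

fromℕ≡n/1 : ∀ n → fromℕ n ≡ + n / 1
fromℕ≡n/1 zero    = refl
fromℕ≡n/1 (suc n) = trans (cong (1ℚ +ℚ_) (trans (fromℕ≡n/1 n) (n/1≡mkℚ n)))
                          (ℚ./-cong (cong (+ 1 +ℤ_) (ℤ.*-identityʳ (+ n))) refl)

fromℕ*inv≡1 : ∀ m → 1 ≤ m → fromℕ m *ℚ inv m ≡ 1ℚ
fromℕ*inv≡1 (suc k) _ =
  trans (cong₂ _*ℚ_ (trans (fromℕ≡n/1 (suc k)) (n/1≡mkℚ (suc k))) (inv≡mkℚ k))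
        (ℚ.*-inverseʳ (mkℚ (+ suc k) 0 (coprime-sym (1-coprimeTo (suc k)))))

inv-* : ∀ m n → inv (m * n) ≡ inv m *ℚ inv n
inv-* zero    n    = sym (ℚ.*-zeroˡ (inv n))
inv-* (suc m) zero = trans (cong inv (ℕ.*-zeroʳ m)) (sym (ℚ.*-zeroʳ (inv (suc m))))
inv-* m@(suc _) n@(suc _) = begin
  R                                          ≡⟨ solve 1 (λ r → r := r :* (con 1ℚ :* con 1ℚ)) refl R ⟩
  R *ℚ (1ℚ *ℚ 1ℚ)                            ≡⟨ cong₂ (λ u v → R *ℚ (u *ℚ v)) (sym (fromℕ*inv≡1 m (s≤s z≤n))) (sym (fromℕ*inv≡1 n (s≤s z≤n))) ⟩
  R *ℚ ((fromℕ m *ℚ P) *ℚ (fromℕ n *ℚ Q))    ≡⟨ solve 5 (λ r p q x y → r :* ((x :* p) :* (y :* q)) := ((x :* y) :* r) :* (p :* q)) refl R P Q (fromℕ m) (fromℕ n) ⟩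
  ((fromℕ m *ℚ fromℕ n) *ℚ R) *ℚ (P *ℚ Q)    ≡⟨ cong (λ u → (u *ℚ R) *ℚ (P *ℚ Q)) (sym (fromℕ-* m n)) ⟩
  (fromℕ (m * n) *ℚ R) *ℚ (P *ℚ Q)           ≡⟨ cong (_*ℚ (P *ℚ Q)) (fromℕ*inv≡1 (m * n) (s≤s z≤n)) ⟩
  1ℚ *ℚ (P *ℚ Q)                             ≡⟨ ℚ.*-identityˡ (P *ℚ Q) ⟩
  P *ℚ Q                                     ∎
  where
  open ≡-Reasoning
  R = inv (m * n)
  P = inv m
  Q = inv n

inv-partialFraction : ∀ {p q} → 1 ≤ p → 1 ≤ q → inv p *ℚ (inv (p + q) -ℚ inv q) ≡ - (inv q *ℚ inv (p + q))
inv-partialFraction {p} {q} 1≤p 1≤q = begin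
  P *ℚ (R -ℚ Q)
    ≡⟨ solve 3 (λ P R Q → P :* (R :- Q) := P :* (R :* con 1ℚ :- Q :* con 1ℚ)) refl P R Q ⟩
  P *ℚ (R *ℚ 1ℚ -ℚ Q *ℚ 1ℚ)
    ≡⟨ cong₂ (λ u v → P *ℚ (R *ℚ u -ℚ Q *ℚ v)) (sym (fromℕ*inv≡1 q 1≤q)) (sym (fromℕ*inv≡1 (p + q) (ℕ.m≤n⇒m≤n+o q 1≤p))) ⟩
  P *ℚ (R *ℚ (fromℕ q *ℚ Q) -ℚ Q *ℚ (fromℕ (p + q) *ℚ R))
    ≡⟨ cong (λ z → P *ℚ (R *ℚ (fromℕ q *ℚ Q) -ℚ Q *ℚ (z *ℚ R))) (fromℕ-+ p q) ⟩
  P *ℚ (R *ℚ (fromℕ q *ℚ Q) -ℚ Q *ℚ ((fromℕ p +ℚ fromℕ q) *ℚ R))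
    ≡⟨ solve 5 (λ P R Q x y → P :* (R :* (y :* Q) :- Q :* ((x :+ y) :* R)) := :- (Q :* R) :* (x :* P)) refl P R Q (fromℕ p) (fromℕ q) ⟩
  - (Q *ℚ R) *ℚ (fromℕ p *ℚ P)  ≡⟨ cong (- (Q *ℚ R) *ℚ_) (fromℕ*inv≡1 p 1≤p) ⟩
  - (Q *ℚ R) *ℚ 1ℚ              ≡⟨ ℚ.*-identityʳ _ ⟩
  - (Q *ℚ R)                    ∎
  where
  open ≡-Reasoning
  P = inv p
  Q = inv q
  R = inv (p + q)

sign-+ : ∀ m n → sign (m + n) ≡ sign m *ℚ sign n
sign-+ zero    n = sym (ℚ.*-identityˡ (sign n))
sign-+ (suc m) n = trans (cong -_ (sign-+ m n)) (ℚ.neg-distribˡ-* (sign m) (sign n))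

sumℚ-++ : ∀ xs ys → sumℚ (xs ++ ys) ≡ sumℚ xs +ℚ sumℚ ys
sumℚ-++ []       ys = sym (ℚ.+-identityˡ _)
sumℚ-++ (x ∷ xs) ys = trans (cong (x +ℚ_) (sumℚ-++ xs ys)) (sym (ℚ.+-assoc x _ _))

module _ {A B : Set} where

  sumℚ-map-∘ : ∀ (f : B → ℚ) (g : A → B) xs → sumℚ (map f (map g xs)) ≡ sumℚ (map (f ∘ g) xs)
  sumℚ-map-∘ f g xs = cong sumℚ (sym (List.map-∘ xs))

  sumℚ-concatMap : ∀ (h : B → ℚ) (f : A → List B) xs →
    sumℚ (map h (concatMap f xs)) ≡ sumℚ (map (λ x → sumℚ (map h (f x))) xs)
  sumℚ-concatMap h f []       = refl
  sumℚ-concatMap h f (x ∷ xs) = begin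
    sumℚ (map h (f x ++ concatMap f xs))                    ≡⟨ cong sumℚ (List.map-++ h (f x) (concatMap f xs)) ⟩
    sumℚ (map h (f x) ++ map h (concatMap f xs))            ≡⟨ sumℚ-++ (map h (f x)) _ ⟩
    sumℚ (map h (f x)) +ℚ sumℚ (map h (concatMap f xs))     ≡⟨ cong (sumℚ (map h (f x)) +ℚ_) (sumℚ-concatMap h f xs) ⟩
    sumℚ (map h (f x)) +ℚ sumℚ (map (λ x → sumℚ (map h (f x))) xs) ∎
    where open ≡-Reasoning

module _ {A : Set} where

  sumℚ-cong-All : ∀ {P : A → Set} (f g : A → ℚ) {xs} → All P xs →
    (∀ x → P x → f x ≡ g x) → sumℚ (map f xs) ≡ sumℚ (map g xs)
  sumℚ-cong-All f g []         _  = refl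
  sumℚ-cong-All f g (px ∷ pxs) eq = cong₂ _+ℚ_ (eq _ px) (sumℚ-cong-All f g pxs eq)

  sumℚ-cong : ∀ (f g : A → ℚ) xs → (∀ x → f x ≡ g x) → sumℚ (map f xs) ≡ sumℚ (map g xs)
  sumℚ-cong f g xs eq = sumℚ-cong-All f g (All.universal {P = λ _ → ⊤} (λ _ → tt) xs) (λ x _ → eq x)

  sumℚ-*ˡ : ∀ c (f : A → ℚ) xs → sumℚ (map (λ x → c *ℚ f x) xs) ≡ c *ℚ sumℚ (map f xs)
  sumℚ-*ˡ c f []       = sym (ℚ.*-zeroʳ c)
  sumℚ-*ˡ c f (x ∷ xs) = trans (cong (c *ℚ f x +ℚ_) (sumℚ-*ˡ c f xs)) (sym (ℚ.*-distribˡ-+ c (f x) _))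

  sumℚ-*ʳ : ∀ c (f : A → ℚ) xs → sumℚ (map (λ x → f x *ℚ c) xs) ≡ sumℚ (map f xs) *ℚ c
  sumℚ-*ʳ c f xs = trans (sumℚ-cong _ _ xs (λ x → ℚ.*-comm (f x) c))
                         (trans (sumℚ-*ˡ c f xs) (ℚ.*-comm c _))

  sumℚ-+ : ∀ (f g : A → ℚ) xs → sumℚ (map (λ x → f x +ℚ g x) xs) ≡ sumℚ (map f xs) +ℚ sumℚ (map g xs)
  sumℚ-+ f g []       = refl
  sumℚ-+ f g (x ∷ xs) = trans (cong (f x +ℚ g x +ℚ_) (sumℚ-+ f g xs))
    (solve 4 (λ a b c d → (a :+ b) :+ (c :+ d) := (a :+ c) :+ (b :+ d)) refl (f x) (g x) _ _)

  sumℚ-- : ∀ (f g : A → ℚ) xs → sumℚ (map (λ x → f x -ℚ g x) xs) ≡ sumℚ (map f xs) -ℚ sumℚ (map g xs)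
  sumℚ-- f g []       = refl
  sumℚ-- f g (x ∷ xs) = trans (cong (f x -ℚ g x +ℚ_) (sumℚ-- f g xs))
    (solve 4 (λ a b c d → (a :- b) :+ (c :- d) := (a :+ c) :- (b :+ d)) refl (f x) (g x) _ _)

  sumℚ-zero : ∀ (f : A → ℚ) {xs} → All (λ x → f x ≡ 0ℚ) xs → sumℚ (map f xs) ≡ 0ℚ
  sumℚ-zero f []         = refl
  sumℚ-zero f (px ∷ pxs) = trans (cong₂ _+ℚ_ px (sumℚ-zero f pxs)) (ℚ.+-identityʳ 0ℚ)

-- Compositions and refinements

-- The helper incHead of comps is local to Defs, so it is exposed through its defining equation.
comps-suc-suc : ∀ k → ∃[ g ] (∀ a c → g (a ∷ c) ≡ suc a ∷ c)
  × comps (suc (suc k)) ≡ map (1 ∷_) (comps (suc k)) ++ map g (comps (suc k))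
comps-suc-suc k = _ , (λ _ _ → refl) , refl

comps-sound : ∀ k → All (IsComposition (suc k)) (comps (suc k))
comps-sound zero    = (s≤s z≤n ∷ [] , refl) ∷ []
comps-sound (suc k) with comps-suc-suc k
... | g , g-∷ , eq rewrite eq =
  ++⁺ (gmap⁺ (λ (ps , s) → s≤s z≤n ∷ ps , cong suc s) (comps-sound k)) (gmap⁺ bump (comps-sound k))
  where
  bump : ∀ {c} → IsComposition (suc k) c → IsComposition (suc (suc k)) (g c)
  bump {a ∷ c} (_ ∷ ps , s) rewrite g-∷ a c = s≤s z≤n ∷ ps , cong suc s

comps-split : ∀ k → ∃[ X ] comps (suc k) ≡ X ++ (suc k ∷ []) ∷ [] × All (λ c → 2 ≤ length c) X
comps-split zero = [] , refl , []
comps-split (suc k) with comps-suc-suc k | comps-split k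
... | g , g-∷ , eq | X , eqX , longX =
  map (1 ∷_) C ++ map g X ,
  trans eq (trans (cong (map (1 ∷_) C ++_) (trans (cong (map g) eqX) (trans (List.map-++ g X _)
                    (cong (λ z → map g X ++ z ∷ []) (g-∷ (suc k) [])))))
                  (sym (List.++-assoc (map (1 ∷_) C) (map g X) _))) ,
  ++⁺ (gmap⁺ cons-long (comps-sound k)) (gmap⁺ bump-long longX)
  where
  C = comps (suc k)
  cons-long : ∀ {c} → IsComposition (suc k) c → 2 ≤ length (1 ∷ c)
  cons-long {_ ∷ _} _ = s≤s (s≤s z≤n)
  bump-long : ∀ {c} → 2 ≤ length c → 2 ≤ length (g c)
  bump-long {a ∷ c} long rewrite g-∷ a c = long

length≤sum : ∀ {xs} → All (1 ≤_) xs → length xs ≤ sum xs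
length≤sum []       = z≤n
length≤sum (p ∷ ps) = ℕ.+-mono-≤ p (length≤sum ps)

refinements-sound : ∀ {β} → All (1 ≤_) β →
  All (λ γ → IsComposition (sum β) γ × length β ≤ length γ) (refinements β)
refinements-sound {[]}        _        = (([] , refl) , z≤n) ∷ []
refinements-sound {suc k ∷ r} (_ ∷ pr) =
  concat⁺ (gmap⁺ (λ cc → gmap⁺ (glue cc) (refinements-sound pr)) (comps-sound k))
  where
  glue : ∀ {c δ} → IsComposition (suc k) c → IsComposition (sum r) δ × length r ≤ length δ →
    IsComposition (suc k + sum r) (c ++ δ) × suc (length r) ≤ length (c ++ δ)
  glue {c@(_ ∷ c′)} {δ} (pc , sc) ((pδ , sδ) , lδ) =
    (++⁺ pc pδ , trans (sum-++ c δ) (cong₂ _+_ sc sδ)) , s≤s (ℕ.≤-trans lδ (List.length-++-≤ʳ δ {c′}))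

sumℚ-refinements-triangular : ∀ (D : List ℕ → ℚ) p {β} → All (1 ≤_) β →
  (∀ {γ} → IsComposition (sum β) γ → length β < length γ → D (p ++ γ) ≡ 0ℚ) →
  sumℚ (map (λ γ → D (p ++ γ)) (refinements β)) ≡ D (p ++ β)
sumℚ-refinements-triangular D p {[]} _ _ = ℚ.+-identityʳ _
sumℚ-refinements-triangular D p {suc k ∷ r} (pk ∷ pr) finer-vanish with comps-split k
... | X , eqX , longX = begin
  sumℚ (map (λ γ → D (p ++ γ)) (refinements (suc k ∷ r)))
    ≡⟨ sumℚ-concatMap (λ γ → D (p ++ γ)) (λ c → map (c ++_) (refinements r)) (comps (suc k)) ⟩
  sumℚ (map T (comps (suc k)))                 ≡⟨ cong (sumℚ ∘ map T) eqX ⟩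
  sumℚ (map T (X ++ (suc k ∷ []) ∷ []))        ≡⟨ cong sumℚ (List.map-++ T X _) ⟩
  sumℚ (map T X ++ T (suc k ∷ []) ∷ [])        ≡⟨ sumℚ-++ (map T X) _ ⟩
  sumℚ (map T X) +ℚ (T (suc k ∷ []) +ℚ 0ℚ)     ≡⟨ cong₂ _+ℚ_ (sumℚ-zero T (All.zipWith T-long (longX , compsX))) (ℚ.+-identityʳ (T (suc k ∷ []))) ⟩
  0ℚ +ℚ T (suc k ∷ [])                         ≡⟨ ℚ.+-identityˡ _ ⟩
  T (suc k ∷ [])                               ≡⟨ sumℚ-map-∘ (λ γ → D (p ++ γ)) (suc k ∷_) (refinements r) ⟩
  sumℚ (map (λ δ → D (p ++ suc k ∷ δ)) (refinements r))
    ≡⟨ sumℚ-cong _ _ (refinements r) (λ δ → cong D (sym (List.++-assoc p (suc k ∷ []) δ))) ⟩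
  sumℚ (map (λ δ → D ((p ++ suc k ∷ []) ++ δ)) (refinements r))
    ≡⟨ sumℚ-refinements-triangular D (p ++ suc k ∷ []) pr finer-vanish′ ⟩
  D ((p ++ suc k ∷ []) ++ r)                   ≡⟨ cong D (List.++-assoc p (suc k ∷ []) r) ⟩
  D (p ++ suc k ∷ r)                           ∎
  where
  open ≡-Reasoning
  T : List ℕ → ℚ
  T c = sumℚ (map (λ γ → D (p ++ γ)) (map (c ++_) (refinements r)))
  compsX : All (IsComposition (suc k)) X
  compsX = ++⁻ˡ X (subst (All (IsComposition (suc k))) eqX (comps-sound k))
  finer-vanish′ : ∀ {γ} → IsComposition (sum r) γ → length r < length γ → D ((p ++ suc k ∷ []) ++ γ) ≡ 0ℚ
  finer-vanish′ {γ} (pγ , sγ) lγ =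
    trans (cong D (List.++-assoc p (suc k ∷ []) γ)) (finer-vanish (pk ∷ pγ , cong (_+_ (suc k)) sγ) (s≤s lγ))
  T-long : ∀ {c} → 2 ≤ length c × IsComposition (suc k) c → T c ≡ 0ℚ
  T-long {c} (long , pc , sc) = trans (sumℚ-map-∘ (λ γ → D (p ++ γ)) (c ++_) (refinements r))
    (sumℚ-zero _ (All.map vanish (refinements-sound pr)))
    where
    vanish : ∀ {δ} → IsComposition (sum r) δ × length r ≤ length δ → D (p ++ (c ++ δ)) ≡ 0ℚ
    vanish {δ} ((pδ , sδ) , lδ) = finer-vanish (++⁺ pc pδ , trans (sum-++ c δ) (cong₂ _+_ sc sδ))
      (ℕ.≤-trans (ℕ.+-mono-≤ long lδ) (ℕ.≤-reflexive (sym (List.length-++ c))))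

evalM-Lfun : ∀ F β → evalM F (Lfun β) ≡ sumℚ (map F (refinements β))
evalM-Lfun F β = trans (sumℚ-map-∘ _ _ (refinements β)) (sumℚ-cong _ _ (refinements β) (λ γ → ℚ.*-identityˡ (F γ)))

L-values-determine-M-values : ∀ n (F G : List ℕ → ℚ) →
  (∀ β → IsComposition n β → evalM F (Lfun β) ≡ evalM G (Lfun β)) →
  ∀ β → IsComposition n β → F β ≡ G β
L-values-determine-M-values n F G agree β cβ =
  x∙y⁻¹≈ε⇒x≈y (F β) (G β) (vanish n cβ (ℕ.m≤n+m n (length β)))
  where
  D : List ℕ → ℚ
  D γ = F γ -ℚ G γ
  vanish-if-finer-vanish : ∀ {β} → IsComposition n β →
    (∀ {γ} → IsComposition n γ → length β < length γ → D γ ≡ 0ℚ) → D β ≡ 0ℚ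
  vanish-if-finer-vanish {β} cβ@(pβ , sβ) finer-vanish = begin
    D β                              ≡⟨ sumℚ-refinements-triangular D [] pβ (λ (pγ , sγ) → finer-vanish (pγ , trans sγ sβ)) ⟨
    sumℚ (map D (refinements β))     ≡⟨ sumℚ-- F G (refinements β) ⟩
    sumℚ (map F (refinements β)) -ℚ sumℚ (map G (refinements β))
                                     ≡⟨ cong₂ _-ℚ_ (evalM-Lfun F β) (evalM-Lfun G β) ⟨
    evalM F (Lfun β) -ℚ evalM G (Lfun β) ≡⟨ cong (_-ℚ evalM G (Lfun β)) (agree β cβ) ⟩
    evalM G (Lfun β) -ℚ evalM G (Lfun β) ≡⟨ ℚ.+-inverseʳ (evalM G (Lfun β)) ⟩
    0ℚ                               ∎
    where open ≡-Reasoning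
  vanish : ∀ k {β} → IsComposition n β → n ≤ length β + k → D β ≡ 0ℚ
  vanish zero {β} cβ bound = vanish-if-finer-vanish cβ λ (pγ , sγ) lt →
    ⊥-elim (ℕ.<⇒≱ (ℕ.<-≤-trans lt (subst (_ ≤_) sγ (length≤sum pγ))) (subst (n ≤_) (ℕ.+-identityʳ _) bound))
  vanish (suc k) {β} cβ bound = vanish-if-finer-vanish cβ λ cγ lt →
    vanish k cγ (ℕ.≤-trans bound (ℕ.≤-trans (ℕ.≤-reflexive (ℕ.+-suc (length β) k)) (ℕ.+-monoˡ-≤ k lt)))

-- MaxOne and MinOne on the monomial basis

lastPart : ℕ → List ℕ → ℕ
lastPart a []      = a
lastPart a (b ∷ r) = lastPart b r

lastPart-++ : ∀ a xs b ys → lastPart a (xs ++ b ∷ ys) ≡ lastPart b ys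
lastPart-++ a []       b ys = refl
lastPart-++ a (x ∷ xs) b ys = lastPart-++ x xs b ys

maxOneOnM : List ℕ → ℚ
maxOneOnM []      = 0ℚ
maxOneOnM (a ∷ r) = sign (length r) *ℚ fromℕ a

minOneOnM : List ℕ → ℚ
minOneOnM []      = 0ℚ
minOneOnM (a ∷ r) = sign (length r) *ℚ fromℕ (lastPart a r)

sumℚ-comps-suc-suc : ∀ (f : List ℕ → ℚ) k → ∃[ g ] (∀ a c → g (a ∷ c) ≡ suc a ∷ c)
  × sumℚ (map f (comps (suc (suc k)))) ≡ sumℚ (map (λ c → f (1 ∷ c) +ℚ f (g c)) (comps (suc k)))
sumℚ-comps-suc-suc f k with comps-suc-suc k
... | g , g-∷ , eq = g , g-∷ , (begin
  sumℚ (map f (comps (suc (suc k))))                     ≡⟨ cong (sumℚ ∘ map f) eq ⟩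
  sumℚ (map f (map (1 ∷_) C ++ map g C))                 ≡⟨ cong sumℚ (List.map-++ f (map (1 ∷_) C) _) ⟩
  sumℚ (map f (map (1 ∷_) C) ++ map f (map g C))         ≡⟨ sumℚ-++ (map f (map (1 ∷_) C)) _ ⟩
  sumℚ (map f (map (1 ∷_) C)) +ℚ sumℚ (map f (map g C))  ≡⟨ cong₂ _+ℚ_ (sumℚ-map-∘ f _ C) (sumℚ-map-∘ f g C) ⟩
  sumℚ (map (λ c → f (1 ∷ c)) C) +ℚ sumℚ (map (f ∘ g) C) ≡⟨ sumℚ-+ _ _ C ⟨
  sumℚ (map (λ c → f (1 ∷ c) +ℚ f (g c)) C)              ∎)
  where
  open ≡-Reasoning
  C = comps (suc k)

sumℚ-comps-sign : ∀ k → sumℚ (map (sign ∘ length) (comps (suc (suc k)))) ≡ 0ℚ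
sumℚ-comps-sign k with sumℚ-comps-suc-suc (sign ∘ length) k
... | g , g-∷ , eq = trans eq (sumℚ-zero _ (All.map cancel (comps-sound k)))
  where
  cancel : ∀ {c} → IsComposition (suc k) c → sign (length (1 ∷ c)) +ℚ sign (length (g c)) ≡ 0ℚ
  cancel {a ∷ c} _ rewrite g-∷ a c = ℚ.+-inverseˡ (sign (length (a ∷ c)))

sumℚ-comps-maxOneOnM : ∀ k → sumℚ (map maxOneOnM (comps (suc k))) ≡ 1ℚ
sumℚ-comps-maxOneOnM zero    = refl
sumℚ-comps-maxOneOnM (suc k) with sumℚ-comps-suc-suc maxOneOnM k
... | g , g-∷ , eq = trans eq (trans (sumℚ-cong-All _ maxOneOnM (comps-sound k) telescope) (sumℚ-comps-maxOneOnM k))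
  where
  telescope : ∀ c → IsComposition (suc k) c → maxOneOnM (1 ∷ c) +ℚ maxOneOnM (g c) ≡ maxOneOnM c
  telescope (a ∷ c) _ rewrite g-∷ a c =
    solve 2 (λ σ x → (:- σ) :* (con 1ℚ :+ con 0ℚ) :+ σ :* (con 1ℚ :+ x) := σ :* x) refl (sign (length c)) (fromℕ a)

sumℚ-comps-minOneOnM : ∀ k → sumℚ (map minOneOnM (comps (suc k))) ≡ 1ℚ
sumℚ-comps-minOneOnM zero    = refl
sumℚ-comps-minOneOnM (suc k) with sumℚ-comps-suc-suc minOneOnM k | comps-split k
... | g , g-∷ , eq | X , eqX , longX = begin
  sumℚ (map minOneOnM (comps (suc (suc k))))  ≡⟨ eq ⟩
  sumℚ (map d (comps (suc k)))                ≡⟨ cong (sumℚ ∘ map d) eqX ⟩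
  sumℚ (map d (X ++ (suc k ∷ []) ∷ []))       ≡⟨ cong sumℚ (List.map-++ d X _) ⟩
  sumℚ (map d X ++ d (suc k ∷ []) ∷ [])       ≡⟨ sumℚ-++ (map d X) _ ⟩
  sumℚ (map d X) +ℚ (d (suc k ∷ []) +ℚ 0ℚ)    ≡⟨ cong₂ _+ℚ_ (sumℚ-zero d (All.map (λ {c} → cancel {c}) longX)) (ℚ.+-identityʳ (d (suc k ∷ []))) ⟩
  0ℚ +ℚ d (suc k ∷ [])                        ≡⟨ ℚ.+-identityˡ _ ⟩
  d (suc k ∷ [])                              ≡⟨ cong (λ z → minOneOnM (1 ∷ suc k ∷ []) +ℚ minOneOnM z) (g-∷ (suc k) []) ⟩
  minOneOnM (1 ∷ suc k ∷ []) +ℚ minOneOnM (suc (suc k) ∷ [])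
    ≡⟨ solve 1 (λ x → (:- con 1ℚ) :* x :+ con 1ℚ :* (con 1ℚ :+ x) := con 1ℚ) refl (fromℕ (suc k)) ⟩
  1ℚ                                          ∎
  where
  open ≡-Reasoning
  d : List ℕ → ℚ
  d c = minOneOnM (1 ∷ c) +ℚ minOneOnM (g c)
  cancel : ∀ {c} → 2 ≤ length c → d c ≡ 0ℚ
  cancel {_ ∷ []} (s≤s ())
  cancel {a ∷ b ∷ c} _ rewrite g-∷ a (b ∷ c) =
    solve 2 (λ σ x → (:- (:- σ)) :* x :+ (:- σ) :* x := con 0ℚ) refl (sign (length c)) (fromℕ (lastPart b c))

sumℚ-refinements-∷ : ∀ (f g h : List ℕ → ℚ) k {r} → All (1 ≤_) r →
  (∀ {c δ} → IsComposition (suc k) c → length r ≤ length δ → f (c ++ δ) ≡ g c *ℚ h δ) →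
  sumℚ (map f (refinements (suc k ∷ r))) ≡ sumℚ (map g (comps (suc k))) *ℚ sumℚ (map h (refinements r))
sumℚ-refinements-∷ f g h k {r} pr factor = begin
  sumℚ (map f (refinements (suc k ∷ r)))
    ≡⟨ sumℚ-concatMap f (λ c → map (c ++_) (refinements r)) (comps (suc k)) ⟩
  sumℚ (map (λ c → sumℚ (map f (map (c ++_) (refinements r)))) (comps (suc k)))
    ≡⟨ sumℚ-cong-All _ _ (comps-sound k) inner ⟩
  sumℚ (map (λ c → g c *ℚ S) (comps (suc k)))   ≡⟨ sumℚ-*ʳ S g (comps (suc k)) ⟩
  sumℚ (map g (comps (suc k))) *ℚ S             ∎
  where
  open ≡-Reasoning
  S = sumℚ (map h (refinements r))
  inner : ∀ c → IsComposition (suc k) c → sumℚ (map f (map (c ++_) (refinements r))) ≡ g c *ℚ S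
  inner c cc = trans (sumℚ-map-∘ f (c ++_) (refinements r))
    (trans (sumℚ-cong-All _ _ (refinements-sound pr) (λ δ (_ , lδ) → factor cc lδ))
           (sumℚ-*ˡ (g c) h (refinements r)))

sumℚ-refinements-sign : ∀ {r} → All (1 ≤_) r →
  sumℚ (map (sign ∘ length) (refinements r)) ≡ (if allOnes r then sign (length r) else 0ℚ)
sumℚ-refinements-sign {[]} _ = refl
sumℚ-refinements-sign {zero ∷ _} (() ∷ _)
sumℚ-refinements-sign {suc k ∷ r} (_ ∷ pr) =
  trans (sumℚ-refinements-∷ (sign ∘ length) (sign ∘ length) (sign ∘ length) k pr
           (λ {c} {δ} _ _ → trans (cong sign (List.length-++ c)) (sign-+ (length c) (length δ))))
        (trans (cong (sumℚ (map (sign ∘ length) (comps (suc k))) *ℚ_) (sumℚ-refinements-sign pr)) (head-sum k))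
  where
  head-sum : ∀ k → sumℚ (map (sign ∘ length) (comps (suc k))) *ℚ (if allOnes r then sign (length r) else 0ℚ)
    ≡ (if allOnes (suc k ∷ r) then sign (length (suc k ∷ r)) else 0ℚ)
  head-sum zero with allOnes r
  ... | true  = solve 1 (λ x → (:- con 1ℚ :+ con 0ℚ) :* x := :- x) refl (sign (length r))
  ... | false = refl
  head-sum (suc k) = trans (cong (_*ℚ (if allOnes r then sign (length r) else 0ℚ)) (sumℚ-comps-sign k))
    (ℚ.*-zeroˡ (if allOnes r then sign (length r) else 0ℚ))

maxOneOnM-isMaxOne : ∀ n → IsMaxOne n maxOneOnM
maxOneOnM-isMaxOne n β (pβ , _) = trans (evalM-Lfun maxOneOnM β) (go pβ)
  where
  go : ∀ {β} → All (1 ≤_) β → sumℚ (map maxOneOnM (refinements β)) ≡ maxOneVal β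
  go {[]} _ = refl
  go {zero ∷ _} (() ∷ _)
  go {suc k ∷ r} (_ ∷ pr) = begin
    sumℚ (map maxOneOnM (refinements (suc k ∷ r)))
      ≡⟨ sumℚ-refinements-∷ maxOneOnM maxOneOnM (sign ∘ length) k pr factor ⟩
    sumℚ (map maxOneOnM (comps (suc k))) *ℚ sumℚ (map (sign ∘ length) (refinements r))
      ≡⟨ cong₂ _*ℚ_ (sumℚ-comps-maxOneOnM k) (sumℚ-refinements-sign pr) ⟩
    1ℚ *ℚ maxOneVal (suc k ∷ r)  ≡⟨ ℚ.*-identityˡ _ ⟩
    maxOneVal (suc k ∷ r)        ∎
    where
    open ≡-Reasoning
    factor : ∀ {c δ} → IsComposition (suc k) c → length r ≤ length δ →
      maxOneOnM (c ++ δ) ≡ maxOneOnM c *ℚ sign (length δ)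
    factor {a ∷ c} {δ} _ _ = begin
      sign (length (c ++ δ)) *ℚ fromℕ a               ≡⟨ cong (λ l → sign l *ℚ fromℕ a) (List.length-++ c) ⟩
      sign (length c + length δ) *ℚ fromℕ a           ≡⟨ cong (_*ℚ fromℕ a) (sign-+ (length c) (length δ)) ⟩
      sign (length c) *ℚ sign (length δ) *ℚ fromℕ a
        ≡⟨ solve 3 (λ σ τ x → σ :* τ :* x := σ :* x :* τ) refl (sign (length c)) (sign (length δ)) (fromℕ a) ⟩
      sign (length c) *ℚ fromℕ a *ℚ sign (length δ)  ∎

minOneOnM-isMinOne : ∀ n → IsMinOne n minOneOnM
minOneOnM-isMinOne n β (pβ , _) = trans (evalM-Lfun minOneOnM β) (go pβ)
  where
  go : ∀ {β} → All (1 ≤_) β → sumℚ (map minOneOnM (refinements β)) ≡ minOneVal β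
  go {[]} _ = refl
  go {zero ∷ _} (() ∷ _)
  go {suc k ∷ []} _ = begin
    sumℚ (map minOneOnM (refinements (suc k ∷ [])))
      ≡⟨ sumℚ-concatMap minOneOnM (λ c → map (c ++_) (refinements [])) (comps (suc k)) ⟩
    sumℚ (map (λ c → minOneOnM (c ++ []) +ℚ 0ℚ) (comps (suc k)))
      ≡⟨ sumℚ-cong _ _ (comps (suc k)) (λ c → trans (ℚ.+-identityʳ _) (cong minOneOnM (List.++-identityʳ c))) ⟩
    sumℚ (map minOneOnM (comps (suc k)))  ≡⟨ sumℚ-comps-minOneOnM k ⟩
    1ℚ                                    ∎
    where open ≡-Reasoning
  go {suc k ∷ b ∷ r} (_ ∷ pr) = begin
    sumℚ (map minOneOnM (refinements (suc k ∷ b ∷ r)))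
      ≡⟨ sumℚ-refinements-∷ minOneOnM (sign ∘ length) minOneOnM k pr factor ⟩
    sumℚ (map (sign ∘ length) (comps (suc k))) *ℚ sumℚ (map minOneOnM (refinements (b ∷ r)))
      ≡⟨ cong (sumℚ (map (sign ∘ length) (comps (suc k))) *ℚ_) (go pr) ⟩
    sumℚ (map (sign ∘ length) (comps (suc k))) *ℚ minOneVal (b ∷ r)
      ≡⟨ head-sum k ⟩
    minOneVal (suc k ∷ b ∷ r) ∎
    where
    open ≡-Reasoning
    head-sum : ∀ k → sumℚ (map (sign ∘ length) (comps (suc k))) *ℚ minOneVal (b ∷ r) ≡ minOneVal (suc k ∷ b ∷ r)
    head-sum zero    = solve 1 (λ x → (:- con 1ℚ :+ con 0ℚ) :* x := :- x) refl (minOneVal (b ∷ r))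
    head-sum (suc k) = trans (cong (_*ℚ minOneVal (b ∷ r)) (sumℚ-comps-sign k)) (ℚ.*-zeroˡ (minOneVal (b ∷ r)))
    factor : ∀ {c δ} → IsComposition (suc k) c → length (b ∷ r) ≤ length δ →
      minOneOnM (c ++ δ) ≡ sign (length c) *ℚ minOneOnM δ
    factor {a ∷ c} {d ∷ δ} _ _ = begin
      sign (length (c ++ d ∷ δ)) *ℚ fromℕ (lastPart a (c ++ d ∷ δ))
        ≡⟨ cong₂ (λ l x → sign l *ℚ fromℕ x) (trans (List.length-++ c) (ℕ.+-suc (length c) (length δ))) (lastPart-++ a c d δ) ⟩
      - sign (length c + length δ) *ℚ fromℕ (lastPart d δ)
        ≡⟨ cong (λ z → - z *ℚ fromℕ (lastPart d δ)) (sign-+ (length c) (length δ)) ⟩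
      - (sign (length c) *ℚ sign (length δ)) *ℚ fromℕ (lastPart d δ)
        ≡⟨ solve 3 (λ σ τ x → :- (σ :* τ) :* x := (:- σ) :* (τ :* x)) refl (sign (length c)) (sign (length δ)) (fromℕ (lastPart d δ)) ⟩
      sign (length (a ∷ c)) *ℚ minOneOnM (d ∷ δ)  ∎

-- Coarsenings and ψ

πFrom : ℕ → List ℕ → ℕ
πFrom s []      = 1
πFrom s (a ∷ r) = (s + a) * πFrom (s + a) r

πc-∷ : ∀ a r → πc (a ∷ r) ≡ a * πFrom a r
πc-∷ a []      = refl
πc-∷ a (b ∷ r) = cong (a *_) (πc-∷ (a + b) r)

πc≡πFrom0 : ∀ γ → πc γ ≡ πFrom 0 γ
πc≡πFrom0 []      = refl
πc≡πFrom0 (a ∷ r) = πc-∷ a r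

πFrom-∷ʳ : ∀ s xs x → πFrom s (xs ++ x ∷ []) ≡ πFrom s xs * (s + sum xs + x)
πFrom-∷ʳ s []       x = trans (ℕ.*-identityʳ (s + x)) (trans (cong (_+ x) (sym (ℕ.+-identityʳ s))) (sym (ℕ.*-identityˡ _)))
πFrom-∷ʳ s (a ∷ xs) x = trans (cong ((s + a) *_) (πFrom-∷ʳ (s + a) xs x))
  (trans (sym (ℕ.*-assoc (s + a) _ _)) (cong (λ z → (s + a) * πFrom (s + a) xs * (z + x)) (ℕ.+-assoc s a (sum xs))))

inv-πc-reverse-∷ : ∀ b r → inv (πc (reverse (b ∷ r))) ≡ inv (πc (reverse r)) *ℚ inv (b + sum r)
inv-πc-reverse-∷ b r = begin
  inv (πc (reverse (b ∷ r)))                 ≡⟨ cong (inv ∘ πc) (List.unfold-reverse b r) ⟩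
  inv (πc (reverse r ++ b ∷ []))             ≡⟨ cong inv (trans (πc≡πFrom0 (reverse r ++ b ∷ [])) (πFrom-∷ʳ 0 (reverse r) b)) ⟩
  inv (πFrom 0 (reverse r) * (sum (reverse r) + b))
    ≡⟨ cong (λ z → inv (πFrom 0 (reverse r) * z)) (trans (cong (_+ b) (sum-↭ (↭-reverse r))) (ℕ.+-comm (sum r) b)) ⟩
  inv (πFrom 0 (reverse r) * (b + sum r))    ≡⟨ inv-* (πFrom 0 (reverse r)) (b + sum r) ⟩
  inv (πFrom 0 (reverse r)) *ℚ inv (b + sum r) ≡⟨ cong (λ z → inv z *ℚ inv (b + sum r)) (πc≡πFrom0 (reverse r)) ⟨
  inv (πc (reverse r)) *ℚ inv (b + sum r)    ∎
  where open ≡-Reasoning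

blockings-nonempty : ∀ b r → All (λ bs → 1 ≤ length bs) (blockings (b ∷ r))
blockings-nonempty b r = concat⁺ (map⁺ (All.universal
  (λ { [] → s≤s z≤n ∷ [] ; (_ ∷ _) → s≤s z≤n ∷ s≤s z≤n ∷ [] }) (blockings r)))

blockings-sound : ∀ {α} → All (1 ≤_) α → All (λ bs → IsComposition (sum α) (map sum bs)) (blockings α)
blockings-sound {[]}    _        = ([] , refl) ∷ []
blockings-sound {a ∷ r} (pa ∷ pr) = concat⁺ (map⁺ (All.map
  (λ { {[]} (_ , s) → (1≤a+0 ∷ [] , trans (ℕ.+-identityʳ (a + 0)) (cong (_+_ a) s)) ∷ []
     ; {B ∷ bs} (pB ∷ pbs , s) →
         (1≤a+0 ∷ pB ∷ pbs , trans (cong (_+ _) (ℕ.+-identityʳ a)) (cong (_+_ a) s))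
       ∷ (ℕ.m≤n⇒m≤n+o (sum B) pa ∷ pbs , trans (ℕ.+-assoc a (sum B) _) (cong (_+_ a) s))
       ∷ [] })
  (blockings-sound pr)))
  where
  1≤a+0 : 1 ≤ a + 0
  1≤a+0 = ℕ.m≤n⇒m≤n+o 0 pa

Σ-blockings : (List (List ℕ) → ℚ) → List ℕ → ℚ
Σ-blockings h α = sumℚ (map h (blockings α))

Σ-blockings-recurrence : ∀ {h : List (List ℕ) → ℚ} a b r c₁ (h₁ : List (List ℕ) → ℚ) c₂ (h₂ : List (List ℕ) → ℚ) →
  (∀ B rest → h ((a ∷ []) ∷ B ∷ rest) ≡ c₁ *ℚ h₁ (B ∷ rest)) →
  (∀ B rest → h ((a ∷ B) ∷ rest) ≡ c₂ *ℚ h₂ (B ∷ rest)) →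
  Σ-blockings h (a ∷ b ∷ r) ≡ c₁ *ℚ Σ-blockings h₁ (b ∷ r) +ℚ c₂ *ℚ Σ-blockings h₂ (b ∷ r)
Σ-blockings-recurrence {h} a b r c₁ h₁ c₂ h₂ split merge =
  trans (sumℚ-concatMap h _ bss)
 (trans (sumℚ-cong-All _ (λ bs → c₁ *ℚ h₁ bs +ℚ c₂ *ℚ h₂ bs) (blockings-nonempty b r)
           λ { [] () ; (B ∷ rest) _ → cong₂ _+ℚ_ (split B rest) (trans (ℚ.+-identityʳ _) (merge B rest)) })
 (trans (sumℚ-+ _ _ bss) (cong₂ _+ℚ_ (sumℚ-*ˡ c₁ h₁ bss) (sumℚ-*ˡ c₂ h₂ bss))))
  where
  bss = blockings (b ∷ r)

-- maxOneTerm 0 and minOneTerm 0 are the terms of MaxOne(ψ_α) and MinOne(ψ_α) indexed by the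
-- coarsenings of α.  In general s is the sum of the parts already merged into the first block, so it
-- shifts the partial sums of that block.
signedWeight : ℕ → List (List ℕ) → ℚ
signedWeight s []         = 0ℚ
signedWeight s (B ∷ rest) = sign (length rest) *ℚ (inv (πFrom s B) *ℚ inv (product (map πc rest)))

maxOneTerm : ℕ → List (List ℕ) → ℚ
maxOneTerm s []         = 0ℚ
maxOneTerm s (B ∷ rest) = signedWeight s (B ∷ rest) *ℚ fromℕ (s + sum B)

minOneTerm : ℕ → List (List ℕ) → ℚ
minOneTerm s []         = 0ℚ
minOneTerm s (B ∷ rest) = signedWeight s (B ∷ rest) *ℚ fromℕ (lastPart (s + sum B) (map sum rest))

signedWeight-split : ∀ s a B rest →
  signedWeight s ((a ∷ []) ∷ B ∷ rest) ≡ - inv (s + a) *ℚ signedWeight 0 (B ∷ rest)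
signedWeight-split s a B rest = begin
  - σ *ℚ (inv ((s + a) * 1) *ℚ inv (πc B * Π))
    ≡⟨ cong₂ (λ u w → - σ *ℚ (inv u *ℚ w)) (ℕ.*-identityʳ (s + a))
             (trans (inv-* (πc B) Π) (cong (λ z → inv z *ℚ inv Π) (πc≡πFrom0 B))) ⟩
  - σ *ℚ (inv (s + a) *ℚ (inv (πFrom 0 B) *ℚ inv Π))
    ≡⟨ solve 4 (λ σ p i j → :- σ :* (p :* (i :* j)) := (:- p) :* (σ :* (i :* j))) refl σ (inv (s + a)) (inv (πFrom 0 B)) (inv Π) ⟩
  - inv (s + a) *ℚ signedWeight 0 (B ∷ rest) ∎
  where
  open ≡-Reasoning
  σ = sign (length rest)
  Π = product (map πc rest)

signedWeight-merge : ∀ s a B rest →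
  signedWeight s ((a ∷ B) ∷ rest) ≡ inv (s + a) *ℚ signedWeight (s + a) (B ∷ rest)
signedWeight-merge s a B rest = begin
  σ *ℚ (inv ((s + a) * πFrom (s + a) B) *ℚ inv Π)
    ≡⟨ cong (λ z → σ *ℚ (z *ℚ inv Π)) (inv-* (s + a) (πFrom (s + a) B)) ⟩
  σ *ℚ ((inv (s + a) *ℚ inv (πFrom (s + a) B)) *ℚ inv Π)
    ≡⟨ solve 4 (λ σ p i j → σ :* ((p :* i) :* j) := p :* (σ :* (i :* j))) refl σ (inv (s + a)) (inv (πFrom (s + a) B)) (inv Π) ⟩
  inv (s + a) *ℚ signedWeight (s + a) (B ∷ rest) ∎
  where
  open ≡-Reasoning
  σ = sign (length rest)
  Π = product (map πc rest)

maxOneTerm-split : ∀ s a B rest → 1 ≤ s + a →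
  maxOneTerm s ((a ∷ []) ∷ B ∷ rest) ≡ - 1ℚ *ℚ signedWeight 0 (B ∷ rest)
maxOneTerm-split s a B rest 1≤s+a = begin
  signedWeight s ((a ∷ []) ∷ B ∷ rest) *ℚ fromℕ (s + (a + 0))
    ≡⟨ cong₂ (λ u w → u *ℚ fromℕ (s + w)) (signedWeight-split s a B rest) (ℕ.+-identityʳ a) ⟩
  (- inv (s + a) *ℚ w) *ℚ fromℕ (s + a)
    ≡⟨ solve 3 (λ p w x → ((:- p) :* w) :* x := (:- con 1ℚ) :* w :* (x :* p)) refl (inv (s + a)) w (fromℕ (s + a)) ⟩
  - 1ℚ *ℚ w *ℚ (fromℕ (s + a) *ℚ inv (s + a)) ≡⟨ cong (- 1ℚ *ℚ w *ℚ_) (fromℕ*inv≡1 (s + a) 1≤s+a) ⟩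
  - 1ℚ *ℚ w *ℚ 1ℚ                              ≡⟨ ℚ.*-identityʳ _ ⟩
  - 1ℚ *ℚ w                                    ∎
  where
  open ≡-Reasoning
  w = signedWeight 0 (B ∷ rest)

maxOneTerm-merge : ∀ s a B rest → maxOneTerm s ((a ∷ B) ∷ rest) ≡ inv (s + a) *ℚ maxOneTerm (s + a) (B ∷ rest)
maxOneTerm-merge s a B rest =
  trans (cong₂ (λ u w → u *ℚ fromℕ w) (signedWeight-merge s a B rest) (sym (ℕ.+-assoc s a (sum B))))
        (ℚ.*-assoc (inv (s + a)) _ _)

minOneTerm-split : ∀ s a B rest →
  minOneTerm s ((a ∷ []) ∷ B ∷ rest) ≡ - inv (s + a) *ℚ minOneTerm 0 (B ∷ rest)
minOneTerm-split s a B rest =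
  trans (cong (_*ℚ fromℕ (lastPart (sum B) (map sum rest))) (signedWeight-split s a B rest))
        (ℚ.*-assoc (- inv (s + a)) _ _)

minOneTerm-merge : ∀ s a B rest → minOneTerm s ((a ∷ B) ∷ rest) ≡ inv (s + a) *ℚ minOneTerm (s + a) (B ∷ rest)
minOneTerm-merge s a B rest =
  trans (cong₂ (λ u w → u *ℚ fromℕ (lastPart w (map sum rest))) (signedWeight-merge s a B rest) (sym (ℕ.+-assoc s a (sum B))))
        (ℚ.*-assoc (inv (s + a)) _ _)

maxOneTerm-singleton : ∀ s a → 1 ≤ s + a → maxOneTerm s ((a ∷ []) ∷ []) ≡ 1ℚ
maxOneTerm-singleton s a 1≤s+a = begin
  1ℚ *ℚ (inv ((s + a) * 1) *ℚ 1ℚ) *ℚ fromℕ (s + (a + 0))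
    ≡⟨ cong₂ (λ u w → 1ℚ *ℚ (inv u *ℚ 1ℚ) *ℚ fromℕ (s + w)) (ℕ.*-identityʳ (s + a)) (ℕ.+-identityʳ a) ⟩
  1ℚ *ℚ (inv (s + a) *ℚ 1ℚ) *ℚ fromℕ (s + a)
    ≡⟨ solve 2 (λ p x → con 1ℚ :* (p :* con 1ℚ) :* x := x :* p) refl (inv (s + a)) (fromℕ (s + a)) ⟩
  fromℕ (s + a) *ℚ inv (s + a)  ≡⟨ fromℕ*inv≡1 (s + a) 1≤s+a ⟩
  1ℚ                            ∎
  where open ≡-Reasoning

Σ-signedWeight : ∀ s a r → All (1 ≤_) (a ∷ r) →
  Σ-blockings (signedWeight s) (a ∷ r) ≡ sign (length r) *ℚ (inv (πc (reverse r)) *ℚ inv (s + (a + sum r)))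
Σ-signedWeight s a [] _ = begin
  1ℚ *ℚ (inv ((s + a) * 1) *ℚ 1ℚ) +ℚ 0ℚ
    ≡⟨ cong (λ u → 1ℚ *ℚ (inv u *ℚ 1ℚ) +ℚ 0ℚ) (trans (ℕ.*-identityʳ (s + a)) (cong (_+_ s) (sym (ℕ.+-identityʳ a)))) ⟩
  1ℚ *ℚ (inv (s + (a + 0)) *ℚ 1ℚ) +ℚ 0ℚ
    ≡⟨ solve 1 (λ p → con 1ℚ :* (p :* con 1ℚ) :+ con 0ℚ := con 1ℚ :* (con 1ℚ :* p)) refl (inv (s + (a + 0))) ⟩
  1ℚ *ℚ (1ℚ *ℚ inv (s + (a + 0)))  ∎
  where open ≡-Reasoning
Σ-signedWeight s a (b ∷ r) (pa ∷ pbr@(pb ∷ _)) = begin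
  Σ-blockings (signedWeight s) (a ∷ b ∷ r)
    ≡⟨ Σ-blockings-recurrence a b r (- P) (signedWeight 0) P (signedWeight (s + a))
         (signedWeight-split s a) (signedWeight-merge s a) ⟩
  - P *ℚ Σ-blockings (signedWeight 0) (b ∷ r) +ℚ P *ℚ Σ-blockings (signedWeight (s + a)) (b ∷ r)
    ≡⟨ cong₂ (λ u w → - P *ℚ u +ℚ P *ℚ w) (Σ-signedWeight 0 b r pbr) (Σ-signedWeight (s + a) b r pbr) ⟩
  - P *ℚ (σ *ℚ (I *ℚ Q)) +ℚ P *ℚ (σ *ℚ (I *ℚ R))
    ≡⟨ solve 5 (λ p σ i q r → (:- p) :* (σ :* (i :* q)) :+ p :* (σ :* (i :* r)) := σ :* i :* (p :* (r :- q))) refl P σ I Q R ⟩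
  σ *ℚ I *ℚ (P *ℚ (R -ℚ Q))
    ≡⟨ cong (σ *ℚ I *ℚ_) (inv-partialFraction (ℕ.m≤n⇒m≤o+n s pa) (ℕ.m≤n⇒m≤n+o (sum r) pb)) ⟩
  σ *ℚ I *ℚ (- (Q *ℚ R))
    ≡⟨ solve 4 (λ σ i q r → σ :* i :* (:- (q :* r)) := :- σ :* ((i :* q) :* r)) refl σ I Q R ⟩
  - σ *ℚ ((I *ℚ Q) *ℚ R)
    ≡⟨ cong₂ (λ u w → - σ *ℚ (u *ℚ inv w)) (inv-πc-reverse-∷ b r) (sym (ℕ.+-assoc s a (b + sum r))) ⟨
  sign (length (b ∷ r)) *ℚ (inv (πc (reverse (b ∷ r))) *ℚ inv (s + (a + sum (b ∷ r))))  ∎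
  where
  open ≡-Reasoning
  P = inv (s + a)
  σ = sign (length r)
  I = inv (πc (reverse r))
  Q = inv (b + sum r)
  R = inv (s + a + (b + sum r))

maxOneSummand : ℕ → List ℕ → ℕ → ℚ
maxOneSummand s α j =
  sign (length α ∸ suc j) *ℚ (inv (πFrom s (take j α)) *ℚ inv (πc (reverse (drop (suc j) α))))

maxOneFormulaFrom : ℕ → List ℕ → ℚ
maxOneFormulaFrom s α = sumℚ (map (maxOneSummand s α) (upTo (length α)))

maxOneFormula≡From0 : ∀ α → maxOneFormula α ≡ maxOneFormulaFrom 0 α
maxOneFormula≡From0 α = sumℚ-cong _ _ (upTo (length α)) λ j →
  cong (λ z → sign (length α ∸ suc j) *ℚ (inv z *ℚ inv (πc (reverse (drop (suc j) α))))) (πc≡πFrom0 (take j α))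

maxOneFormulaFrom-∷ : ∀ s a r → maxOneFormulaFrom s (a ∷ r)
  ≡ sign (length r) *ℚ inv (πc (reverse r)) +ℚ inv (s + a) *ℚ maxOneFormulaFrom (s + a) r
maxOneFormulaFrom-∷ s a r = cong₂ _+ℚ_ (cong (sign (length r) *ℚ_) (ℚ.*-identityˡ _)) (begin
  sumℚ (map (maxOneSummand s (a ∷ r)) (applyUpTo suc (length r)))
    ≡⟨ cong sumℚ (trans (List.map-applyUpTo suc _ (length r)) (sym (List.map-upTo _ (length r)))) ⟩
  sumℚ (map (maxOneSummand s (a ∷ r) ∘ suc) (upTo (length r)))
    ≡⟨ sumℚ-cong _ _ (upTo (length r)) shift ⟩
  sumℚ (map (λ j → inv (s + a) *ℚ maxOneSummand (s + a) r j) (upTo (length r)))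
    ≡⟨ sumℚ-*ˡ (inv (s + a)) (maxOneSummand (s + a) r) (upTo (length r)) ⟩
  inv (s + a) *ℚ maxOneFormulaFrom (s + a) r  ∎)
  where
  open ≡-Reasoning
  shift : ∀ j → maxOneSummand s (a ∷ r) (suc j) ≡ inv (s + a) *ℚ maxOneSummand (s + a) r j
  shift j = trans (cong (λ z → σ *ℚ (z *ℚ K)) (inv-* (s + a) (πFrom (s + a) (take j r))))
    (solve 4 (λ σ p i k → σ :* ((p :* i) :* k) := p :* (σ :* (i :* k))) refl σ (inv (s + a)) (inv (πFrom (s + a) (take j r))) K)
    where
    σ = sign (length r ∸ suc j)
    K = inv (πc (reverse (drop (suc j) r)))

Σ-maxOneTerm : ∀ s {α} → All (1 ≤_) α → Σ-blockings (maxOneTerm s) α ≡ maxOneFormulaFrom s α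
Σ-maxOneTerm s {[]}         _         = refl
Σ-maxOneTerm s {a ∷ []}     (pa ∷ []) = trans (ℚ.+-identityʳ _) (maxOneTerm-singleton s a (ℕ.m≤n⇒m≤o+n s pa))
Σ-maxOneTerm s {a ∷ b ∷ r} (pa ∷ pbr) = begin
  Σ-blockings (maxOneTerm s) (a ∷ b ∷ r)
    ≡⟨ Σ-blockings-recurrence a b r (- 1ℚ) (signedWeight 0) P (maxOneTerm (s + a))
         (λ B rest → maxOneTerm-split s a B rest (ℕ.m≤n⇒m≤o+n s pa)) (maxOneTerm-merge s a) ⟩
  - 1ℚ *ℚ Σ-blockings (signedWeight 0) (b ∷ r) +ℚ P *ℚ Σ-blockings (maxOneTerm (s + a)) (b ∷ r)
    ≡⟨ cong₂ (λ u w → - 1ℚ *ℚ u +ℚ P *ℚ w) (Σ-signedWeight 0 b r pbr) (Σ-maxOneTerm (s + a) pbr) ⟩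
  - 1ℚ *ℚ (σ *ℚ (I *ℚ Q)) +ℚ P *ℚ Φ
    ≡⟨ cong (_+ℚ P *ℚ Φ) (solve 3 (λ σ i q → (:- con 1ℚ) :* (σ :* (i :* q)) := (:- σ) :* (i :* q)) refl σ I Q) ⟩
  - σ *ℚ (I *ℚ Q) +ℚ P *ℚ Φ
    ≡⟨ cong (λ z → - σ *ℚ z +ℚ P *ℚ Φ) (inv-πc-reverse-∷ b r) ⟨
  sign (length (b ∷ r)) *ℚ inv (πc (reverse (b ∷ r))) +ℚ P *ℚ Φ
    ≡⟨ maxOneFormulaFrom-∷ s a (b ∷ r) ⟨
  maxOneFormulaFrom s (a ∷ b ∷ r)  ∎
  where
  open ≡-Reasoning
  P = inv (s + a)
  σ = sign (length r)
  I = inv (πc (reverse r))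
  Q = inv (b + sum r)
  Φ = maxOneFormulaFrom (s + a) (b ∷ r)

singletonIndicator : List ℕ → ℚ
singletonIndicator (_ ∷ []) = 1ℚ
singletonIndicator _        = 0ℚ

singletonIndicator-≢ : ∀ {n α} → IsComposition n α → α ≢ n ∷ [] → singletonIndicator α ≡ 0ℚ
singletonIndicator-≢ {α = []}        _        _   = refl
singletonIndicator-≢ {α = a ∷ []}    (_ , a+0≡n) α≢ = ⊥-elim (α≢ (cong (_∷ []) (trans (sym (ℕ.+-identityʳ a)) a+0≡n)))
singletonIndicator-≢ {α = _ ∷ _ ∷ _} _        _   = refl

Σ-minOneTerm : ∀ s {α} → All (1 ≤_) α → Σ-blockings (minOneTerm s) α ≡ singletonIndicator α
Σ-minOneTerm s {[]}         _         = refl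
Σ-minOneTerm s {a ∷ []}     (pa ∷ []) = trans (ℚ.+-identityʳ _) (maxOneTerm-singleton s a (ℕ.m≤n⇒m≤o+n s pa))
Σ-minOneTerm s {a ∷ b ∷ r} (pa ∷ pbr) = begin
  Σ-blockings (minOneTerm s) (a ∷ b ∷ r)
    ≡⟨ Σ-blockings-recurrence a b r (- P) (minOneTerm 0) P (minOneTerm (s + a))
         (minOneTerm-split s a) (minOneTerm-merge s a) ⟩
  - P *ℚ Σ-blockings (minOneTerm 0) (b ∷ r) +ℚ P *ℚ Σ-blockings (minOneTerm (s + a)) (b ∷ r)
    ≡⟨ cong₂ (λ u w → - P *ℚ u +ℚ P *ℚ w) (Σ-minOneTerm 0 pbr) (Σ-minOneTerm (s + a) pbr) ⟩
  - P *ℚ singletonIndicator (b ∷ r) +ℚ P *ℚ singletonIndicator (b ∷ r)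
    ≡⟨ solve 2 (λ p x → (:- p) :* x :+ p :* x := con 0ℚ) refl P (singletonIndicator (b ∷ r)) ⟩
  0ℚ  ∎
  where
  open ≡-Reasoning
  P = inv (s + a)

ψ-coefficient≡signedWeight : ∀ B rest t →
  inv (product (map πc (B ∷ rest))) *ℚ (sign (length (map sum rest)) *ℚ t) ≡ signedWeight 0 (B ∷ rest) *ℚ t
ψ-coefficient≡signedWeight B rest t = begin
  inv (πc B * Π) *ℚ (sign (length (map sum rest)) *ℚ t)
    ≡⟨ cong₂ (λ u l → u *ℚ (sign l *ℚ t)) (trans (inv-* (πc B) Π) (cong (λ z → inv z *ℚ inv Π) (πc≡πFrom0 B)))
             (List.length-map sum rest) ⟩
  (inv (πFrom 0 B) *ℚ inv Π) *ℚ (sign (length rest) *ℚ t)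
    ≡⟨ solve 4 (λ i j σ x → (i :* j) :* (σ :* x) := σ :* (i :* j) :* x) refl (inv (πFrom 0 B)) (inv Π) (sign (length rest)) t ⟩
  signedWeight 0 (B ∷ rest) *ℚ t  ∎
  where
  open ≡-Reasoning
  Π = product (map πc rest)

evalM-maxOneOnM-psi : ∀ α → evalM maxOneOnM (psi α) ≡ Σ-blockings (maxOneTerm 0) α
evalM-maxOneOnM-psi α = trans (sumℚ-map-∘ _ _ (blockings α)) (sumℚ-cong _ _ (blockings α) λ
  { [] → refl ; (B ∷ rest) → ψ-coefficient≡signedWeight B rest (fromℕ (sum B)) })

evalM-minOneOnM-psi : ∀ α → evalM minOneOnM (psi α) ≡ Σ-blockings (minOneTerm 0) α
evalM-minOneOnM-psi α = trans (sumℚ-map-∘ _ _ (blockings α)) (sumℚ-cong _ _ (blockings α) λ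
  { [] → refl ; (B ∷ rest) → ψ-coefficient≡signedWeight B rest (fromℕ (lastPart (sum B) (map sum rest))) })

evalM-psi-cong : ∀ {n α} (F G : List ℕ → ℚ) → IsComposition n α →
  (∀ β → IsComposition n β → F β ≡ G β) → evalM F (psi α) ≡ evalM G (psi α)
evalM-psi-cong {α = α} F G (pα , refl) agree = trans (sumℚ-map-∘ _ _ (blockings α))
  (trans (sumℚ-cong-All _ _ (blockings-sound pα) λ bs cβ → cong (inv (product (map πc bs)) *ℚ_) (agree (map sum bs) cβ))
         (sym (sumℚ-map-∘ _ _ (blockings α))))

lemma3p3 : ∀ (n : ℕ) → 1 ≤ n → (α : List ℕ) → IsComposition n α →
    (∀ (F : List ℕ → ℚ) → IsMaxOne n F → evalM F (psi α) ≡ maxOneFormula α)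
    × (∀ (F : List ℕ → ℚ) → IsMinOne n F →
         (α ≡ n ∷ [] → evalM F (psi α) ≡ 1ℚ) × (α ≢ n ∷ [] → evalM F (psi α) ≡ 0ℚ))
lemma3p3 n _ α cα@(pα , _) = maxOne , minOne
  where
  open ≡-Reasoning
  maxOne : ∀ F → IsMaxOne n F → evalM F (psi α) ≡ maxOneFormula α
  maxOne F isMaxOne = begin
    evalM F (psi α)
      ≡⟨ evalM-psi-cong F maxOneOnM cα (L-values-determine-M-values n F maxOneOnM λ β cβ →
           trans (isMaxOne β cβ) (sym (maxOneOnM-isMaxOne n β cβ))) ⟩
    evalM maxOneOnM (psi α)       ≡⟨ evalM-maxOneOnM-psi α ⟩
    Σ-blockings (maxOneTerm 0) α  ≡⟨ Σ-maxOneTerm 0 pα ⟩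
    maxOneFormulaFrom 0 α         ≡⟨ maxOneFormula≡From0 α ⟨
    maxOneFormula α               ∎
  minOne : ∀ F → IsMinOne n F → (α ≡ n ∷ [] → evalM F (psi α) ≡ 1ℚ) × (α ≢ n ∷ [] → evalM F (psi α) ≡ 0ℚ)
  minOne F isMinOne = (λ α≡[n] → trans value (cong singletonIndicator α≡[n]))
                    , (λ α≢[n] → trans value (singletonIndicator-≢ cα α≢[n]))
    where
    value : evalM F (psi α) ≡ singletonIndicator α
    value = begin
      evalM F (psi α)
        ≡⟨ evalM-psi-cong F minOneOnM cα (L-values-determine-M-values n F minOneOnM λ β cβ →
             trans (isMinOne β cβ) (sym (minOneOnM-isMinOne n β cβ))) ⟩
      evalM minOneOnM (psi α)       ≡⟨ evalM-minOneOnM-psi α ⟩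
      Σ-blockings (minOneTerm 0) α  ≡⟨ Σ-minOneTerm 0 pα ⟩
      singletonIndicator α          ∎
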